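{- Let $G$ be a first-order structure expanding a group, and let $A\subseteq G$ be a definable set which is stable. Then $A$ has the productset property if and only if $A$ has the $1$-sided productset property.
   Context: A definable set $A\subseteq G$ is called stable if the two-variable formula $x\cdot y\in A$ does not have the order property, i.e. there are no sequences $(b_i)_{i<\omega}$, $(c_j)_{j<\omega}$ in $G$ such that $b_i\cdot c_j\in A$ holds if and only if $i\leq j$. A set $A\subseteq G$ has the productset property if there are infinite sets $B,C\subseteq G$ with $B\cdot C=\{b\cdot c: b\in B, c\in C\}\subseteq A$. A set $A\subseteq G$ has the $1$-sided productset property if there are infinite sequences $(b_i)_{i<\omega}$ and $(c_i)_{i<\omega}$ in $G$ (each consisting of pairwise distinct elements) such that $b_i\cdot c_j\in A$ for all $i\leq j<\omega$. -}

module Defs where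

open import Level using (Level; _⊔_; suc)
open import Algebra.Bundles using (Group)
open import Data.Nat using (ℕ; _≤_)
open import Data.Product using (Σ; Σ-syntax; _×_)
open import Data.List using (List)
open import Data.List.Relation.Unary.Any using (Any)
open import Relation.Nullary using (¬_)
open import Relation.Binary.PropositionalEquality using (_≢_)
open import Relation.Unary using (Pred)

module _ {c ℓ : Level} (G : Group c ℓ) where
  open Group G

  PairwiseDistinct : (ℕ → Carrier) → Set ℓ
  PairwiseDistinct b = ∀ {i j} → i ≢ j → ¬ (b i ≈ b j)

  Finite : {q : Level} → Pred Carrier q → Set (c ⊔ ℓ ⊔ q)
  Finite B = Σ[ xs ∈ List Carrier ] (∀ x → B x → Any (x ≈_) xs)

  Infinite : {q : Level} → Pred Carrier q → Set (c ⊔ ℓ ⊔ q)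
  Infinite B = ¬ Finite B

  module _ {p : Level} (A : Pred Carrier p) where

    OrderProperty : Set (c ⊔ p)
    OrderProperty = Σ[ b ∈ (ℕ → Carrier) ] Σ[ d ∈ (ℕ → Carrier) ]
      (∀ i j → (A (b i ∙ d j) → i ≤ j) × (i ≤ j → A (b i ∙ d j)))

    Stable : Set (c ⊔ p)
    Stable = ¬ OrderProperty

    ProductsetProperty : Set (suc (c ⊔ ℓ) ⊔ p)
    ProductsetProperty = Σ[ B ∈ Pred Carrier (c ⊔ ℓ) ] Σ[ C ∈ Pred Carrier (c ⊔ ℓ) ]
      (Infinite B × Infinite C × (∀ x y → B x → C y → A (x ∙ y)))

    OneSidedProductsetProperty : Set (c ⊔ ℓ ⊔ p)
    OneSidedProductsetProperty = Σ[ b ∈ (ℕ → Carrier) ] Σ[ d ∈ (ℕ → Carrier) ]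
      (PairwiseDistinct b × PairwiseDistinct d × (∀ i j → i ≤ j → A (b i ∙ d j)))

-- Colour each pair i > j by whether b i · d j ∈ A. By Ramsey's theorem some infinite set of
-- indices is monochromatic. If its pairs i > j lie outside A, the subsequences of b and d
-- together with the 1-sided hypothesis witness the order property, contradicting stability;
-- so they lie in A, and the two subsequences form infinite B and C with B · C ⊆ A.
module Submission where

open import Defs
open import Level using (Level; _⊔_; Lift; lift; lower)
open import Algebra.Bundles using (Group)
open import Axiom.ExcludedMiddle using (ExcludedMiddle)
open import Data.Bool using (Bool; true; false)
open import Data.Empty using (⊥-elim)
open import Data.Fin using (toℕ)
open import Data.Fin.Properties using (pigeonhole)
open import Data.List using (List; []; _∷_; lookup)
open import Data.List.Relation.Unary.Any using (Any; here; there; index)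
open import Data.List.Relation.Unary.Any.Properties using (lookup-index)
open import Data.Nat using (ℕ; zero; suc; _≤_; _<_; _≤?_; s≤s) renaming (_⊔_ to _⊔ₙ_)
open import Data.Nat.Properties
  using (≤-refl; ≤-trans; <-trans; <⇒≤; <⇒≢; ≰⇒>; <-cmp; m≤n⇒m<n∨m≡n; m≤m⊔n; m≤n⊔m)
open import Data.Product using (Σ-syntax; _×_; _,_; proj₁; proj₂)
open import Data.Sum using (inj₁; inj₂)
open import Data.Unit.Polymorphic using (⊤)
open import Function.Base using (_∘_)
open import Function.Bundles using (_⇔_; mk⇔)
open import Relation.Binary.Definitions using (Monotonic₁; tri<; tri≈; tri>)
open import Relation.Binary.PropositionalEquality using (_≡_; refl; sym; cong; _≢_)
open import Relation.Nullary using (¬_; yes; no)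
open import Relation.Nullary.Decidable using (map′)
open import Relation.Unary using (Pred)
import Relation.Binary.Reasoning.Setoid

private
  variable
    q : Level

lowerExcludedMiddle : {a b : Level} → ExcludedMiddle (a ⊔ b) → ExcludedMiddle a
lowerExcludedMiddle {b = b} em {P} = map′ lower lift (em {Lift b P})

StrictlyIncreasing : (ℕ → ℕ) → Set
StrictlyIncreasing = Monotonic₁ _<_ _<_

stepwise⇒strictlyIncreasing : {f : ℕ → ℕ} → (∀ k → f k < f (suc k)) → StrictlyIncreasing f
stepwise⇒strictlyIncreasing step {i} {suc j} (s≤s i≤j) with m≤n⇒m<n∨m≡n i≤j
... | inj₁ i<j  = <-trans (stepwise⇒strictlyIncreasing step i<j) (step j)
... | inj₂ refl = step j

strictlyIncreasing⇒monotone : {f : ℕ → ℕ} → StrictlyIncreasing f → Monotonic₁ _≤_ _≤_ f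
strictlyIncreasing⇒monotone f-inc i≤j with m≤n⇒m<n∨m≡n i≤j
... | inj₁ i<j  = <⇒≤ (f-inc i<j)
... | inj₂ refl = ≤-refl

strictlyIncreasing⇒≢ : {f : ℕ → ℕ} → StrictlyIncreasing f → ∀ {i j} → i ≢ j → f i ≢ f j
strictlyIncreasing⇒≢ f-inc {i} {j} i≢j with <-cmp i j
... | tri< i<j _ _ = <⇒≢ (f-inc i<j)
... | tri≈ _ i≡j _ = ⊥-elim (i≢j i≡j)
... | tri> _ _ j<i = λ fi≡fj → <⇒≢ (f-inc j<i) (sym fi≡fj)

Unbounded : Pred ℕ q → Set q
Unbounded S = ∀ n → Σ[ m ∈ ℕ ] n ≤ m × S m

⊤-unbounded : Unbounded {q} (λ _ → ⊤)
⊤-unbounded n = n , ≤-refl , _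

unbounded-beyond : {S : Pred ℕ q} → Unbounded S → ∀ k → Unbounded (λ m → S m × k < m)
unbounded-beyond S-unb k n with S-unb (n ⊔ₙ suc k)
... | m , n⊔1+k≤m , m∈S = m , ≤-trans (m≤m⊔n n (suc k)) n⊔1+k≤m , m∈S , ≤-trans (m≤n⊔m n (suc k)) n⊔1+k≤m

module _ {S : Pred ℕ q} (S-unb : Unbounded S) where

  enumerate : ℕ → ℕ
  enumerate zero    = proj₁ (S-unb 0)
  enumerate (suc k) = proj₁ (S-unb (suc (enumerate k)))

  enumerate-∈ : ∀ k → S (enumerate k)
  enumerate-∈ zero    = proj₂ (proj₂ (S-unb 0))
  enumerate-∈ (suc k) = proj₂ (proj₂ (S-unb (suc (enumerate k))))

  enumerate-strictlyIncreasing : StrictlyIncreasing enumerate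
  enumerate-strictlyIncreasing =
    stepwise⇒strictlyIncreasing (λ k → proj₁ (proj₂ (S-unb (suc (enumerate k)))))

Literal : Bool → Set q → Set q
Literal true  X = X
Literal false X = ¬ X

literal-transport : {r : Level} {c d : Bool} {X : Set q} →
                    Literal c (Lift r (d ≡ true)) → Literal d X → Literal c X
literal-transport {c = true}              (lift refl) x = x
literal-transport {c = false} {d = false} _           x = x
literal-transport {c = false} {d = true}  d≢true      _ = ⊥-elim (d≢true (lift refl))

module _ (em : ExcludedMiddle q) where

  unbounded-split : {S : Pred ℕ q} → Unbounded S → (P : Pred ℕ q) →
                    Σ[ c ∈ Bool ] Unbounded (λ m → S m × Literal c (P m))
  unbounded-split {S} S-unb P with em {Unbounded (λ m → S m × P m)}
  ... | yes SP-unb = true , SP-unb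
  ... | no ¬SP-unb = false , S¬P-unb
    where
      S¬P-unb : Unbounded (λ m → S m × ¬ P m)
      S¬P-unb n with em {Σ[ m ∈ ℕ ] n ≤ m × S m × ¬ P m}
      ... | yes found = found
      ... | no none   = ⊥-elim (¬SP-unb SP-unb)
        where
          SP-unb : Unbounded (λ m → S m × P m)
          SP-unb n′ with S-unb (n ⊔ₙ n′)
          ... | m , n⊔n′≤m , m∈S with em {P m}
          ...   | yes Pm = m , ≤-trans (m≤n⊔m n n′) n⊔n′≤m , m∈S , Pm
          ...   | no ¬Pm = ⊥-elim (none (m , ≤-trans (m≤m⊔n n n′) n⊔n′≤m , m∈S , ¬Pm))

  -- Stage k + 1 keeps the elements m beyond the pivot of stage k for which R m (pivot k) has
  -- one fixed truth value, colour k; so every pivot relates to all later pivots with its own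
  -- colour, and a colour taken by infinitely many pivots gives the subsequence.
  module _ (R : ℕ → ℕ → Set q) where

    private
      Stage : Set (Level.suc q)
      Stage = Σ[ S ∈ Pred ℕ q ] Unbounded S

      head : Stage → ℕ
      head (_ , S-unb) = proj₁ (S-unb 0)

      head-∈ : (st : Stage) → proj₁ st (head st)
      head-∈ (_ , S-unb) = proj₂ (proj₂ (S-unb 0))

      Beyond : Stage → Bool → Pred ℕ q
      Beyond st c m = (proj₁ st m × head st < m) × Literal c (R m (head st))

      refine : (st : Stage) → Σ[ c ∈ Bool ] Unbounded (Beyond st c)
      refine st = unbounded-split (unbounded-beyond (proj₂ st) (head st)) (λ m → R m (head st))

      stage : ℕ → Stage
      stage zero    = (λ _ → ⊤) , ⊤-unbounded
      stage (suc k) = Beyond (stage k) (proj₁ (refine (stage k))) , proj₂ (refine (stage k))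

      colour : ℕ → Bool
      colour k = proj₁ (refine (stage k))

      pivot : ℕ → ℕ
      pivot k = head (stage k)

      stage-⊆ : ∀ {k l m} → k < l → proj₁ (stage l) m → proj₁ (stage (suc k)) m
      stage-⊆ {k} {suc l} (s≤s k≤l) m∈l with m≤n⇒m<n∨m≡n k≤l
      ... | inj₁ k<l  = stage-⊆ k<l (proj₁ (proj₁ m∈l))
      ... | inj₂ refl = m∈l

      pivot-later : ∀ {k l} → k < l → pivot k < pivot l × Literal (colour k) (R (pivot l) (pivot k))
      pivot-later {l = l} k<l with stage-⊆ k<l (head-∈ (stage l))
      ... | (_ , pivot-k<pivot-l) , lit = pivot-k<pivot-l , lit

      recurrent-colour : Σ[ c ∈ Bool ] Unbounded (λ k → ⊤ × Literal c (Lift q (colour k ≡ true)))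
      recurrent-colour = unbounded-split ⊤-unbounded (λ k → Lift q (colour k ≡ true))

    ramsey : Σ[ h ∈ (ℕ → ℕ) ] StrictlyIncreasing h ×
             Σ[ c ∈ Bool ] (∀ {i j} → j < i → Literal c (R (h i) (h j)))
    ramsey with recurrent-colour
    ... | c , same-colour = pivot ∘ g , (λ i<j → proj₁ (pivot-later (g-increasing i<j))) , c ,
          λ {i} {j} j<i → literal-transport (proj₂ (enumerate-∈ same-colour j))
                                            (proj₂ (pivot-later (g-increasing j<i)))
      where
        g : ℕ → ℕ
        g = enumerate same-colour
        g-increasing : StrictlyIncreasing g
        g-increasing = enumerate-strictlyIncreasing same-colour

module _ {c ℓ : Level} (G : Group c ℓ) where
  open Group G using (Carrier; _≈_; _∙_; ∙-cong; setoid) renaming (refl to ≈-refl; sym to ≈-sym)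

  Image : (ℕ → Carrier) → Pred Carrier (c ⊔ ℓ)
  Image s x = Lift c (Σ[ k ∈ ℕ ] x ≈ s k)

  pairwiseDistinct-∘ : {s : ℕ → Carrier} {h : ℕ → ℕ} →
                       PairwiseDistinct G s → StrictlyIncreasing h → PairwiseDistinct G (s ∘ h)
  pairwiseDistinct-∘ s-distinct h-increasing i≢j = s-distinct (strictlyIncreasing⇒≢ h-increasing i≢j)

  pairwiseDistinct⇒infinite : {s : ℕ → Carrier} {B : Pred Carrier q} →
                              PairwiseDistinct G s → (∀ k → B (s k)) → Infinite G B
  pairwiseDistinct⇒infinite {s = s} s-distinct s∈B (xs , cover) =
    let i , j , i<j , same-position = pigeonhole ≤-refl (λ k → index (position (toℕ k)))
    in s-distinct (<⇒≢ i<j) (begin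
      s (toℕ i)                            ≈⟨ lookup-index (position (toℕ i)) ⟩
      lookup xs (index (position (toℕ i))) ≡⟨ cong (lookup xs) same-position ⟩
      lookup xs (index (position (toℕ j))) ≈⟨ lookup-index (position (toℕ j)) ⟨
      s (toℕ j)                            ∎)
    where
      open Relation.Binary.Reasoning.Setoid setoid
      position : ∀ k → Any (s k ≈_) xs
      position k = cover (s k) (s∈B k)

  module _ (em : ExcludedMiddle (c ⊔ ℓ ⊔ q)) {B : Pred Carrier q} (B-infinite : Infinite G B) where

    private
      fresh : (xs : List Carrier) → Σ[ x ∈ Carrier ] B x × ¬ Any (x ≈_) xs
      fresh xs with em {Σ[ x ∈ Carrier ] B x × ¬ Any (x ≈_) xs}
      ... | yes found = found
      ... | no none   = ⊥-elim (B-infinite (xs , covered))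
        where
          covered : ∀ x → B x → Any (x ≈_) xs
          covered x x∈B with lowerExcludedMiddle {b = q} em {Any (x ≈_) xs}
          ... | yes x∈xs = x∈xs
          ... | no x∉xs  = ⊥-elim (none (x , x∈B , x∉xs))

      chosen : ℕ → List Carrier
      chosen zero    = []
      chosen (suc n) = proj₁ (fresh (chosen n)) ∷ chosen n

      next : ℕ → Carrier
      next n = proj₁ (fresh (chosen n))

      next-∈-chosen : ∀ {x i j} → i < j → x ≈ next i → Any (x ≈_) (chosen j)
      next-∈-chosen {i = i} {suc j} (s≤s i≤j) x≈next with m≤n⇒m<n∨m≡n i≤j
      ... | inj₁ i<j  = there (next-∈-chosen i<j x≈next)
      ... | inj₂ refl = here x≈next

      next-distinct : PairwiseDistinct G next
      next-distinct {i} {j} i≢j next-i≈next-j with <-cmp i j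
      ... | tri< i<j _ _ = proj₂ (proj₂ (fresh (chosen j))) (next-∈-chosen i<j (≈-sym next-i≈next-j))
      ... | tri≈ _ i≡j _ = i≢j i≡j
      ... | tri> _ _ j<i = proj₂ (proj₂ (fresh (chosen i))) (next-∈-chosen j<i next-i≈next-j)

    infinite⇒pairwiseDistinct : Σ[ s ∈ (ℕ → Carrier) ] PairwiseDistinct G s × (∀ k → B (s k))
    infinite⇒pairwiseDistinct = next , next-distinct , λ n → proj₁ (proj₂ (fresh (chosen n)))

  module _ {p : Level} {A : Pred Carrier p} where

    productset⇒oneSidedProductset : ExcludedMiddle (c ⊔ ℓ) →
                                    ProductsetProperty G A → OneSidedProductsetProperty G A
    productset⇒oneSidedProductset em (B , C , B-infinite , C-infinite , B∙C⊆A)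
      with infinite⇒pairwiseDistinct em B-infinite | infinite⇒pairwiseDistinct em C-infinite
    ... | b , b-distinct , b∈B | d , d-distinct , d∈C =
      b , d , b-distinct , d-distinct , λ i j _ → B∙C⊆A (b i) (d j) (b∈B i) (d∈C j)

    halfGraph⇒orderProperty : {b d : ℕ → Carrier} →
                              (∀ i j → i ≤ j → A (b i ∙ d j)) → (∀ {i j} → j < i → ¬ A (b i ∙ d j)) →
                              OrderProperty G A
    halfGraph⇒orderProperty {b} {d} upper lower = b , d , λ i j → reflect i j , upper i j
      where
        reflect : ∀ i j → A (b i ∙ d j) → i ≤ j
        reflect i j bd∈A with i ≤? j
        ... | yes i≤j = i≤j
        ... | no  i≰j = ⊥-elim (lower (≰⇒> i≰j) bd∈A)

    grid⇒productset : (∀ {x y} → x ≈ y → A x → A y) → {b d : ℕ → Carrier} →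
                      PairwiseDistinct G b → PairwiseDistinct G d → (∀ i j → A (b i ∙ d j)) →
                      ProductsetProperty G A
    grid⇒productset A-resp {b} {d} b-distinct d-distinct grid =
      Image b , Image d ,
      pairwiseDistinct⇒infinite b-distinct (λ k → lift (k , ≈-refl)) ,
      pairwiseDistinct⇒infinite d-distinct (λ k → lift (k , ≈-refl)) ,
      λ { x y (lift (i , x≈bi)) (lift (j , y≈dj)) → A-resp (∙-cong (≈-sym x≈bi) (≈-sym y≈dj)) (grid i j) }

    oneSidedProductset⇒productset : ExcludedMiddle p → (∀ {x y} → x ≈ y → A x → A y) → Stable G A →
                                    OneSidedProductsetProperty G A → ProductsetProperty G A
    oneSidedProductset⇒productset em A-resp stable (b , d , b-distinct , d-distinct , upper)
      with ramsey em (λ i j → A (b i ∙ d j))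
    ... | h , h-increasing , false , lower-out =
      ⊥-elim (stable (halfGraph⇒orderProperty (λ i j i≤j → upper _ _ (h-monotone i≤j)) lower-out))
      where h-monotone = strictlyIncreasing⇒monotone h-increasing
    ... | h , h-increasing , true , lower-in =
      grid⇒productset A-resp (pairwiseDistinct-∘ b-distinct h-increasing)
                             (pairwiseDistinct-∘ d-distinct h-increasing) grid
      where
        grid : ∀ i j → A (b (h i) ∙ d (h j))
        grid i j with i ≤? j
        ... | yes i≤j = upper _ _ (strictlyIncreasing⇒monotone h-increasing i≤j)
        ... | no  i≰j = lower-in (≰⇒> i≰j)

proposition2p5 : {c ℓ p : Level} → ExcludedMiddle (c ⊔ ℓ ⊔ p) →
    (G : Group c ℓ) (A : Pred (Group.Carrier G) p) →
    (∀ {x y} → Group._≈_ G x y → A x → A y) →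
    Stable G A →
    ProductsetProperty G A ⇔ OneSidedProductsetProperty G A
proposition2p5 {c} {ℓ} {p} em G A A-resp stable =
  mk⇔ (productset⇒oneSidedProductset G {A = A} (lowerExcludedMiddle {b = p} em))
      (oneSidedProductset⇒productset G (lowerExcludedMiddle {b = c ⊔ ℓ} em) A-resp stable)
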